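{- Let $\mathcal{A}$ be a $\mathbf{tDL}$-algebra. If $A^d\neq\{0,1\}$, then $\mathcal{A}$ is not simple.
   Context: A $\mathbf{tDL}$-algebra is a bounded distributive lattice $\langle A,\wedge,\vee,0,1\rangle$ with unary operators $\mathbf{G},\mathbf{H},\mathbf{F},\mathbf{P}$ such that for all $x,y$: $\mathbf{G}1=\mathbf{H}1=1$; $\mathbf{G},\mathbf{H}$ preserve $\wedge$; $x\le\mathbf{G}\mathbf{P}x$, $x\le\mathbf{H}\mathbf{F}x$; $\mathbf{G}(x\vee y)\le\mathbf{G}x\vee\mathbf{F}y$, $\mathbf{H}(x\vee y)\le\mathbf{H}x\vee\mathbf{P}y$; $\mathbf{F}0=\mathbf{P}0=0$; $\mathbf{F},\mathbf{P}$ preserve $\vee$; $\mathbf{P}\mathbf{G}x\le x$, $\mathbf{F}\mathbf{H}x\le x$; $\mathbf{G}x\wedge\mathbf{F}y\le\mathbf{F}(x\wedge y)$, $\mathbf{H}x\wedge\mathbf{P}y\le\mathbf{P}(x\wedge y)$. Simplicity refers to congruences of this algebra. $A^d=\{x\in A:x=\mathbf{G}x\wedge x\wedge\mathbf{H}x\}$. -}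

module Defs where

open import Level using (Level; _⊔_; suc)
open import Data.Product using (_×_)
open import Data.Sum using (_⊎_)
open import Relation.Nullary using (¬_)
open import Relation.Binary.Core using (Rel)
open import Relation.Binary.Structures using (IsEquivalence)
open import Algebra.Core using (Op₁; Op₂)
open import Algebra.Lattice.Structures using (IsDistributiveLattice)

record TDLAlgebra (c ℓ : Level) : Set (suc (c ⊔ ℓ)) where
  infixr 7 _∧_
  infixr 6 _∨_
  infix 4 _≈_ _≤_
  field
    Carrier : Set c
    _≈_     : Rel Carrier ℓ
    _∨_     : Op₂ Carrier
    _∧_     : Op₂ Carrier
    𝟎       : Carrier
    𝟏       : Carrier
    G H F P : Op₁ Carrier
    isDistributiveLattice : IsDistributiveLattice _≈_ _∨_ _∧_
    ∨-identityˡ : ∀ x → (𝟎 ∨ x) ≈ x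
    ∧-identityˡ : ∀ x → (𝟏 ∧ x) ≈ x
    G-cong : ∀ {x y} → x ≈ y → G x ≈ G y
    H-cong : ∀ {x y} → x ≈ y → H x ≈ H y
    F-cong : ∀ {x y} → x ≈ y → F x ≈ F y
    P-cong : ∀ {x y} → x ≈ y → P x ≈ P y

  _≤_ : Rel Carrier ℓ
  x ≤ y = (x ∧ y) ≈ x

  field
    G1 : G 𝟏 ≈ 𝟏
    H1 : H 𝟏 ≈ 𝟏
    G-∧ : ∀ x y → G (x ∧ y) ≈ (G x ∧ G y)
    H-∧ : ∀ x y → H (x ∧ y) ≈ (H x ∧ H y)
    x≤GPx : ∀ x → x ≤ G (P x)
    x≤HFx : ∀ x → x ≤ H (F x)
    G-∨ : ∀ x y → G (x ∨ y) ≤ (G x ∨ F y)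
    H-∨ : ∀ x y → H (x ∨ y) ≤ (H x ∨ P y)
    F0 : F 𝟎 ≈ 𝟎
    P0 : P 𝟎 ≈ 𝟎
    F-∨ : ∀ x y → F (x ∨ y) ≈ (F x ∨ F y)
    P-∨ : ∀ x y → P (x ∨ y) ≈ (P x ∨ P y)
    PGx≤x : ∀ x → P (G x) ≤ x
    FHx≤x : ∀ x → F (H x) ≤ x
    G-F : ∀ x y → (G x ∧ F y) ≤ F (x ∧ y)
    H-P : ∀ x y → (H x ∧ P y) ≤ P (x ∧ y)

  open IsDistributiveLattice isDistributiveLattice public
    using (isEquivalence)

  _∈Aᵈ : Carrier → Set ℓ
  x ∈Aᵈ = x ≈ (G x ∧ (x ∧ H x))

  Aᵈ≡01 : Set (c ⊔ ℓ)
  Aᵈ≡01 = (∀ x → x ∈Aᵈ → (x ≈ 𝟎) ⊎ (x ≈ 𝟏)) × (𝟎 ∈Aᵈ) × (𝟏 ∈Aᵈ)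

  record IsCongruence (θ : Rel Carrier (c ⊔ ℓ)) : Set (c ⊔ ℓ) where
    field
      isEquiv : IsEquivalence θ
      ≈⊆θ     : ∀ {x y} → x ≈ y → θ x y
      ∧-comp  : ∀ {x x′ y y′} → θ x x′ → θ y y′ → θ (x ∧ y) (x′ ∧ y′)
      ∨-comp  : ∀ {x x′ y y′} → θ x x′ → θ y y′ → θ (x ∨ y) (x′ ∨ y′)
      G-comp  : ∀ {x y} → θ x y → θ (G x) (G y)
      H-comp  : ∀ {x y} → θ x y → θ (H x) (H y)
      F-comp  : ∀ {x y} → θ x y → θ (F x) (F y)
      P-comp  : ∀ {x y} → θ x y → θ (P x) (P y)

  Simple : Set (suc (c ⊔ ℓ))
  Simple = ¬ (𝟎 ≈ 𝟏)
         × (∀ θ → IsCongruence θ →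
              (∀ x y → θ x y → x ≈ y) ⊎ (∀ x y → θ x y))

{-# OPTIONS --safe #-}
-- For d ∈ Aᵈ the relation  x ∧ d ≈ y ∧ d  is a congruence: it is the kernel of
-- the lattice endomorphism _∧ d, and d ≤ G d, d ≤ H d let G, H, F, P pass
-- through it (for F and P via the axioms G x ∧ F y ≤ F (x ∧ y),
-- H x ∧ P y ≤ P (x ∧ y)).  In a simple algebra it is therefore the identity,
-- whence d ∧ d ≈ 𝟏 ∧ d gives d ≈ 𝟏, or total, whence 𝟎 ∧ d ≈ 𝟏 ∧ d gives d ≈ 𝟎.
module Submission where

open import Defs
open import Level using (Level; _⊔_; Lift; lift; lower)
open import Relation.Nullary using (¬_)
open import Data.Product using (_,_)
open import Data.Sum using (_⊎_; inj₁; inj₂)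
open import Function using (_∘_)
open import Algebra.Core using (Op₁)
open import Algebra.Bundles using (IdempotentCommutativeMonoid)
open import Algebra.Lattice.Bundles using (Lattice)
open import Algebra.Lattice.Structures using (IsDistributiveLattice)
import Algebra.Properties.IdempotentCommutativeMonoid as IdempotentCommutativeMonoidProperties
import Algebra.Lattice.Properties.Lattice as LatticeProperties
import Relation.Binary.Lattice as OrderTheoretic
import Relation.Binary.Lattice.Properties.JoinSemilattice as JoinSemilatticeProperties
import Relation.Binary.Lattice.Properties.MeetSemilattice as MeetSemilatticeProperties
import Relation.Binary.Reasoning.PartialOrder as PartialOrderReasoning

module TDLAlgebraProperties {c ℓ : Level} (𝒜 : TDLAlgebra c ℓ) where

  open TDLAlgebra 𝒜 renaming (_≤_ to _≤ᴬ_)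
  open IsDistributiveLattice isDistributiveLattice
    using ( isLattice; refl; sym; trans; ∧-comm; ∧-cong; ∧-congˡ; ∧-congʳ
          ; ∨-cong; ∧-absorbs-∨; ∧-distribʳ-∨)

  lattice : Lattice c ℓ
  lattice = record { isLattice = isLattice }

  open LatticeProperties lattice using (∧-idem; ∧-isSemigroup; ∨-∧-orderTheoreticLattice)
  open OrderTheoretic.Lattice ∨-∧-orderTheoreticLattice
    using (_≤_; poset; joinSemilattice; meetSemilattice; x∧y≤x; x∧y≤y; ∧-greatest; x≤x∨y; antisym)
    renaming (refl to ≤-refl; trans to ≤-trans; reflexive to ≤-reflexive)
  open JoinSemilatticeProperties joinSemilattice using (x≤y⇒x∨y≈y)
  open MeetSemilatticeProperties meetSemilattice using (∧-monotonic)
  open PartialOrderReasoning poset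

  -- The library order is x ≤ y = x ≈ x ∧ y; the axioms use x ∧ y ≈ x.
  ≤ᴬ⇒≤ : ∀ {x y} → x ≤ᴬ y → x ≤ y
  ≤ᴬ⇒≤ = sym

  ∧-idempotentCommutativeMonoid : IdempotentCommutativeMonoid c ℓ
  ∧-idempotentCommutativeMonoid = record
    { isIdempotentCommutativeMonoid = record
      { isCommutativeMonoid = record
        { isMonoid = record
          { isSemigroup = ∧-isSemigroup
          ; identity    = ∧-identityˡ , λ x → trans (∧-comm x 𝟏) (∧-identityˡ x)
          }
        ; comm = ∧-comm
        }
      ; idem = ∧-idem
      }
    }

  open IdempotentCommutativeMonoidProperties ∧-idempotentCommutativeMonoid
    using () renaming (∙-distrʳ-∙ to ∧-distribʳ-∧)

  ∧-zeroˡ : ∀ x → 𝟎 ∧ x ≈ 𝟎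
  ∧-zeroˡ x = trans (∧-congˡ (sym (∨-identityˡ x))) (∧-absorbs-∨ 𝟎 x)

  ∧-preserving⇒monotone : ∀ {h : Op₁ Carrier} → (∀ {x y} → x ≈ y → h x ≈ h y) →
                          (∀ x y → h (x ∧ y) ≈ h x ∧ h y) → ∀ {x y} → x ≤ y → h x ≤ h y
  ∧-preserving⇒monotone h-cong h-∧ {x} {y} x≤y = trans (h-cong x≤y) (h-∧ x y)

  ∨-preserving⇒monotone : ∀ {h : Op₁ Carrier} → (∀ {x y} → x ≈ y → h x ≈ h y) →
                          (∀ x y → h (x ∨ y) ≈ h x ∨ h y) → ∀ {x y} → x ≤ y → h x ≤ h y
  ∨-preserving⇒monotone {h} h-cong h-∨ {x} {y} x≤y = begin
    h x         ≤⟨ x≤x∨y (h x) (h y) ⟩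
    h x ∨ h y   ≈⟨ h-∨ x y ⟨
    h (x ∨ y)   ≈⟨ h-cong (x≤y⇒x∨y≈y x≤y) ⟩
    h y         ∎

  G-monotone : ∀ {x y} → x ≤ y → G x ≤ G y
  G-monotone = ∧-preserving⇒monotone G-cong G-∧

  H-monotone : ∀ {x y} → x ≤ y → H x ≤ H y
  H-monotone = ∧-preserving⇒monotone H-cong H-∧

  F-monotone : ∀ {x y} → x ≤ y → F x ≤ F y
  F-monotone = ∨-preserving⇒monotone F-cong F-∨

  P-monotone : ∀ {x y} → x ≤ y → P x ≤ P y
  P-monotone = ∨-preserving⇒monotone P-cong P-∨

  𝟎∈Aᵈ : 𝟎 ∈Aᵈ
  𝟎∈Aᵈ = sym (begin-equality
    G 𝟎 ∧ (𝟎 ∧ H 𝟎)   ≈⟨ ∧-congˡ (∧-zeroˡ (H 𝟎)) ⟩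
    G 𝟎 ∧ 𝟎           ≈⟨ ∧-comm (G 𝟎) 𝟎 ⟩
    𝟎 ∧ G 𝟎           ≈⟨ ∧-zeroˡ (G 𝟎) ⟩
    𝟎                 ∎)

  𝟏∈Aᵈ : 𝟏 ∈Aᵈ
  𝟏∈Aᵈ = sym (begin-equality
    G 𝟏 ∧ (𝟏 ∧ H 𝟏)   ≈⟨ ∧-cong G1 (∧-identityˡ (H 𝟏)) ⟩
    𝟏 ∧ H 𝟏           ≈⟨ ∧-identityˡ (H 𝟏) ⟩
    H 𝟏               ≈⟨ H1 ⟩
    𝟏                 ∎)

  module ∧-Kernel {d : Carrier} (d∈Aᵈ : d ∈Aᵈ) where

    _∼_ : Carrier → Carrier → Set (c ⊔ ℓ)
    x ∼ y = Lift c (x ∧ d ≈ y ∧ d)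

    d≤Gd : d ≤ G d
    d≤Gd = ≤-trans (≤-reflexive d∈Aᵈ) (x∧y≤x (G d) (d ∧ H d))

    d≤Hd : d ≤ H d
    d≤Hd = ≤-trans (≤-reflexive d∈Aᵈ)
                   (≤-trans (x∧y≤y (G d) (d ∧ H d)) (x∧y≤y d (H d)))

    ∼-intro : ∀ {x y} → x ∧ d ≤ y → y ∧ d ≤ x → x ∼ y
    ∼-intro {x} {y} p q =
      lift (antisym (∧-greatest p (x∧y≤y x d)) (∧-greatest q (x∧y≤y y d)))

    monotone-∼-compatible : ∀ {h : Op₁ Carrier} → (∀ {x y} → x ≈ y → h x ≈ h y) →
                            (∀ {x y} → x ≤ y → h x ≤ h y) →
                            (∀ x → h x ∧ d ≤ h (x ∧ d)) →
                            ∀ {x y} → x ∼ y → h x ∼ h y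
    monotone-∼-compatible {h} h-cong h-monotone h-∧d {x} {y} (lift x∧d≈y∧d) =
      ∼-intro (pass x∧d≈y∧d) (pass (sym x∧d≈y∧d))
      where
      pass : ∀ {u v} → u ∧ d ≈ v ∧ d → h u ∧ d ≤ h v
      pass {u} {v} u∧d≈v∧d = begin
        h u ∧ d     ≤⟨ h-∧d u ⟩
        h (u ∧ d)   ≈⟨ h-cong u∧d≈v∧d ⟩
        h (v ∧ d)   ≤⟨ h-monotone (x∧y≤x v d) ⟩
        h v         ∎

    G-∧d : ∀ x → G x ∧ d ≤ G (x ∧ d)
    G-∧d x = begin
      G x ∧ d     ≤⟨ ∧-monotonic ≤-refl d≤Gd ⟩
      G x ∧ G d   ≈⟨ G-∧ x d ⟨
      G (x ∧ d)   ∎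

    H-∧d : ∀ x → H x ∧ d ≤ H (x ∧ d)
    H-∧d x = begin
      H x ∧ d     ≤⟨ ∧-monotonic ≤-refl d≤Hd ⟩
      H x ∧ H d   ≈⟨ H-∧ x d ⟨
      H (x ∧ d)   ∎

    F-∧d : ∀ x → F x ∧ d ≤ F (x ∧ d)
    F-∧d x = begin
      F x ∧ d     ≈⟨ ∧-comm (F x) d ⟩
      d ∧ F x     ≤⟨ ∧-monotonic d≤Gd ≤-refl ⟩
      G d ∧ F x   ≤⟨ ≤ᴬ⇒≤ (G-F d x) ⟩
      F (d ∧ x)   ≈⟨ F-cong (∧-comm d x) ⟩
      F (x ∧ d)   ∎

    P-∧d : ∀ x → P x ∧ d ≤ P (x ∧ d)
    P-∧d x = begin
      P x ∧ d     ≈⟨ ∧-comm (P x) d ⟩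
      d ∧ P x     ≤⟨ ∧-monotonic d≤Hd ≤-refl ⟩
      H d ∧ P x   ≤⟨ ≤ᴬ⇒≤ (H-P d x) ⟩
      P (d ∧ x)   ≈⟨ P-cong (∧-comm d x) ⟩
      P (x ∧ d)   ∎

    isCongruence : IsCongruence _∼_
    isCongruence = record
      { isEquiv = record
        { refl  = lift refl
        ; sym   = λ (lift p) → lift (sym p)
        ; trans = λ (lift p) (lift q) → lift (trans p q)
        }
      ; ≈⊆θ    = λ x≈y → lift (∧-congʳ x≈y)
      ; ∧-comp = λ {x} {x′} {y} {y′} (lift p) (lift q) → lift (begin-equality
          (x ∧ y) ∧ d          ≈⟨ ∧-distribʳ-∧ d x y ⟩
          (x ∧ d) ∧ (y ∧ d)    ≈⟨ ∧-cong p q ⟩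
          (x′ ∧ d) ∧ (y′ ∧ d)  ≈⟨ ∧-distribʳ-∧ d x′ y′ ⟨
          (x′ ∧ y′) ∧ d        ∎)
      ; ∨-comp = λ {x} {x′} {y} {y′} (lift p) (lift q) → lift (begin-equality
          (x ∨ y) ∧ d          ≈⟨ ∧-distribʳ-∨ d x y ⟩
          (x ∧ d) ∨ (y ∧ d)    ≈⟨ ∨-cong p q ⟩
          (x′ ∧ d) ∨ (y′ ∧ d)  ≈⟨ ∧-distribʳ-∨ d x′ y′ ⟨
          (x′ ∨ y′) ∧ d        ∎)
      ; G-comp = monotone-∼-compatible G-cong G-monotone G-∧d
      ; H-comp = monotone-∼-compatible H-cong H-monotone H-∧d
      ; F-comp = monotone-∼-compatible F-cong F-monotone F-∧d
      ; P-comp = monotone-∼-compatible P-cong P-monotone P-∧d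
      }

    simple⇒≈𝟎⊎≈𝟏 : Simple → (d ≈ 𝟎) ⊎ (d ≈ 𝟏)
    simple⇒≈𝟎⊎≈𝟏 (_ , simple) with simple _∼_ isCongruence
    ... | inj₁ ∼⊆≈     = inj₂ (∼⊆≈ d 𝟏 d∼𝟏)
      where
      d∼𝟏 : d ∼ 𝟏
      d∼𝟏 = lift (trans (∧-idem d) (sym (∧-identityˡ d)))
    ... | inj₂ ∼-total = inj₁ (begin-equality
      d       ≈⟨ ∧-identityˡ d ⟨
      𝟏 ∧ d   ≈⟨ lower (∼-total 𝟎 𝟏) ⟨
      𝟎 ∧ d   ≈⟨ ∧-zeroˡ d ⟩
      𝟎       ∎)

  simple⇒Aᵈ≡01 : Simple → Aᵈ≡01
  simple⇒Aᵈ≡01 simple =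
    (λ d d∈Aᵈ → ∧-Kernel.simple⇒≈𝟎⊎≈𝟏 d∈Aᵈ simple) , 𝟎∈Aᵈ , 𝟏∈Aᵈ

corollary4p20 : ∀ {c ℓ : Level} (𝒜 : TDLAlgebra c ℓ) →
                ¬ TDLAlgebra.Aᵈ≡01 𝒜 → ¬ TDLAlgebra.Simple 𝒜
corollary4p20 𝒜 ¬Aᵈ≡01 = ¬Aᵈ≡01 ∘ simple⇒Aᵈ≡01
  where open TDLAlgebraProperties 𝒜
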